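{- Let $\mathcal{A} = (X, \{R_i \mid i \in \mathcal{I}\})$ be a symmetric association scheme with $R_0 = \mathrm{Id}_X$, and let $\tilde{0} \subseteq \mathcal{I}$ be an imprimitivity set of $\mathcal{A}$. Suppose that for some $i \in \tilde{0}$ and some $j \in \mathcal{I} \setminus \tilde{0}$ the intersection numbers satisfy $p^j_{ij} = e-1$ and $p^j_{i'j} = 0$ for all $i' \in \tilde{0} \setminus \{0, i\}$. Suppose that $Y$ and $Y'$ are equivalence classes of $R_{\tilde{0}}$ such that the graphs $\Gamma_i|_Y$ and $\Gamma_i|_{Y'}$ are both isomorphic to the Hamming graph $H(d, e)$ for some $d < e$, and such that for all $x \in Y$, $y \in Y'$ we have $(x, y) \in R_{j'}$ for some $j' \in \tilde{\jmath}$. Then the graph $\Gamma_j|_{Y \cup Y'}$ is isomorphic to $e^{d-1} K_{e,e}$ (the disjoint union of $e^{d-1}$ copies of $K_{e,e}$), and the partitions of $Y$ and of $Y'$ induced by the connected components of $\Gamma_j|_{Y \cup Y'}$ are spreads of $\Gamma_i|_Y$ and $\Gamma_i|_{Y'}$, respectively, i.e., partitions of $Y$ (resp. $Y'$) into maximal $R_i$-cliques of size $e$.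
   Context: A symmetric association scheme is a pair $\mathcal{A} = (X, \{R_i \mid i \in \mathcal{I}\})$ where $X$ is a finite set and the $R_i$ are nonempty symmetric binary relations on $X$ partitioning $X^2$, with $R_0 = \mathrm{Id}_X = \{(x,x) \mid x \in X\}$, such that there are numbers $p^h_{ij}$ ($h,i,j \in \mathcal{I}$), the intersection numbers, with the property that for every $(x,y) \in R_h$ there are exactly $p^h_{ij}$ vertices $z \in X$ with $(x,z) \in R_i$ and $(z,y) \in R_j$. For $i \ne 0$, $\Gamma_i = (X, R_i)$ is the (undirected) graph with edge relation $R_i$, and for $Z \subseteq X$, $\Gamma_i|_Z$ denotes the induced subgraph on $Z$. An imprimitivity set is a set $\tilde{0} \subseteq \mathcal{I}$ such that $R_{\tilde{0}} := \bigcup_{i \in \tilde{0}} R_i$ is an equivalence relation on $X$. It determines an equivalence relation $\sim$ on $\mathcal{I}$ by $h \sim j$ iff $p^h_{ij'} \ne 0$ for some $j' \in \tilde{0}$... precisely: $h \sim j \iff \exists\, i \in \tilde{0}$ with $p^h_{ij} \neq 0$; $\tilde{\jmath}$ denotes the equivalence class of $j$ under $\sim$. An $R_i$-clique is a set of vertices pairwise in relation $R_i$. The Hamming graph $H(d,e)$ has vertex set $\{1,\dots,e\}^d$, two vertices adjacent iff they differ in exactly one coordinate. -}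

module Defs where

open import Data.Nat using (ℕ; zero; suc; _+_)
open import Data.Bool using (Bool; true; false; if_then_else_)
open import Data.Fin using (Fin; zero; suc)
open import Data.Fin.Properties using (_≟_)
open import Data.Vec using (Vec; lookup)
open import Data.Product using (Σ; ∃; ∃-syntax; _×_; _,_)
open import Data.Sum using (_⊎_)
open import Relation.Nullary using (¬_; Dec; yes; no)
open import Relation.Binary using (IsEquivalence)
open import Relation.Binary.PropositionalEquality using (_≡_; _≢_)
open import Function.Bundles using (_⇔_)

countFin : (n : ℕ) → (Fin n → Bool) → ℕ
countFin zero    f = 0
countFin (suc n) f = (if f zero then 1 else 0) + countFin n (λ z → f (suc z))

⌊_⌋ : ∀ {P : Set} → Dec P → Bool
⌊ yes _ ⌋ = true
⌊ no _ ⌋  = false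

_∧_ : Bool → Bool → Bool
true ∧ b = b
false ∧ _ = false

-- Symmetric association scheme on X = Fin n with index set I = Fin (suc m),
-- index 0 = zero.  R x y is the (unique) class containing (x , y).
record AssocScheme (n m : ℕ) : Set where
  field
    R        : Fin n → Fin n → Fin (suc m)
    R-sym    : ∀ x y → R x y ≡ R y x
    R-id     : ∀ x y → (R x y ≡ zero) ⇔ (x ≡ y)
    R-nonempty : ∀ i → ∃[ x ] ∃[ y ] (R x y ≡ i)
    p        : Fin (suc m) → Fin (suc m) → Fin (suc m) → ℕ   -- p h i j = p^h_{ij}
    p-law    : ∀ x y i j →
               countFin n (λ z → ⌊ R x z ≟ i ⌋ ∧ ⌊ R z y ≟ j ⌋) ≡ p (R x y) i j

open AssocScheme public

module _ {n m : ℕ} (A : AssocScheme n m) where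

  RSet : (Fin (suc m) → Set) → Fin n → Fin n → Set
  RSet T x y = T (R A x y)

  IsImprimitivitySet : (Fin (suc m) → Set) → Set
  IsImprimitivitySet T = IsEquivalence (RSet T)

  Tilde : (Fin (suc m) → Set) → Fin (suc m) → Fin (suc m) → Set
  Tilde T h j = ∃[ i ] (T i × p A h i j ≢ 0)

  IsClass : (Fin (suc m) → Set) → (Fin n → Set) → Set
  IsClass T Y = ∃[ y₀ ] (∀ x → Y x ⇔ RSet T y₀ x)

  Γ : Fin (suc m) → Fin n → Fin n → Set
  Γ i x y = R A x y ≡ i

  ΓOn : Fin (suc m) → (Fin n → Set) → Fin n → Fin n → Set
  ΓOn i Z x y = Z x × Z y × R A x y ≡ i

data Path {n : ℕ} (E : Fin n → Fin n → Set) : Fin n → Fin n → Set where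
  here : ∀ {x} → Path E x x
  step : ∀ {x y z} → E x y → Path E y z → Path E x z

record GraphIso {V : Set} (Adj : V → V → Set) {n : ℕ}
                (S : Fin n → Set) (E : Fin n → Fin n → Set) : Set where
  field
    f     : V → Fin n
    f-inj : ∀ u v → f u ≡ f v → u ≡ v
    f-in  : ∀ v → S (f v)
    f-onto : ∀ x → S x → ∃[ v ] (f v ≡ x)
    f-adj : ∀ u v → E (f u) (f v) ⇔ Adj u v

HammingAdj : (d e : ℕ) → Vec (Fin e) d → Vec (Fin e) d → Set
HammingAdj d e u v =
  ∃[ k ] (lookup u k ≢ lookup v k × (∀ k' → k' ≢ k → lookup u k' ≡ lookup v k'))

-- c K_{e,e}: vertices (copy , side , index) ∈ Fin c × Bool × Fin e,
-- adjacent iff same copy and different sides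
KeeUnionAdj : (c e : ℕ) → (Fin c × Bool × Fin e) → (Fin c × Bool × Fin e) → Set
KeeUnionAdj c e (a , s , _) (a' , s' , _) = a ≡ a' × s ≢ s'

HasSize : {n : ℕ} → (Fin n → Set) → ℕ → Set
HasSize {n} B e = ∃[ v ] ((∀ k l → lookup {n = e} v k ≡ lookup v l → k ≡ l) × (∀ y → B y ⇔ (∃[ k ] (lookup v k ≡ y))))

module _ {n m : ℕ} (A : AssocScheme n m) where

  IsMaxCliqueOfSize : Fin (suc m) → (Fin n → Set) → ℕ → (Fin n → Set) → Set
  IsMaxCliqueOfSize i Y e B =
      (∀ y → B y → Y y)
    × (∀ y z → B y → B z → y ≢ z → R A y z ≡ i)
    × (∀ z → Y z → ¬ B z → ¬ (∀ y → B y → R A z y ≡ i))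
    × HasSize B e

  InducedPartitionIsSpread : (i j : Fin (suc m)) (e : ℕ) (Y Y' : Fin n → Set) → Set
  InducedPartitionIsSpread i j e Y Y' =
    ∀ x → Y x →
      IsMaxCliqueOfSize i Y e
        (λ y → Y y × Path (ΓOn A j (λ z → Y z ⊎ Y' z)) x y)

{-# OPTIONS --safe #-}
module Submission where

-- Write B u v when (f u , g v) ∈ R_j, where f and g coordinatise Y and Y′ as H(d,e).
-- Since p^j_{i′j} = 0 for i′ ∈ 0̃ ∖ {0, i}, the B-neighbours of a vertex are pairwise
-- Γ_i-adjacent, and since p^j_{ij} = e − 1 there are e of them; a clique of size e in H(d,e)
-- is a line, so every B-neighbourhood is a line.  The e lines N(v), v ∈ N(u), all pass
-- through u, and as d < e two of them have the same direction κ u; then every point of the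
-- κ u-line through u has the neighbourhood N(u).  Hence the j-edges between Y and Y′ form one
-- K_{e,e} between each κ-line of Y and a line of Y′, and there are e^d / e such lines.

open import Defs
open import Data.Nat using (ℕ; zero; suc; _*_; _^_; _≤_; _<_; _∸_; z≤n; s≤s)
open import Data.Nat.Properties using (1+n≰n; *-cancelʳ-≡; *-comm)
open import Data.Bool using (Bool; true; false)
open import Data.Fin using (Fin; zero; suc; punchIn; punchOut) renaming (_<_ to _<ᶠ_)
open import Data.Fin.Properties
  using ( _≟_; nonZeroIndex; <-irrefl; any?; pigeonhole; injective⇒≤; cantor-schröder-bernstein
        ; punchInᵢ≢i; punchOut-injective; suc-injective; *↔×)
open import Data.Vec using (Vec; []; _∷_; lookup; tabulate; _[_]≔_)
open import Data.Vec.Properties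
  using (≡-dec; lookup∘update; lookup∘update′; lookup∘tabulate; tabulate∘lookup; tabulate-cong)
open import Data.Product using (∃; ∃-syntax; _×_; _,_; proj₁; proj₂; uncurry)
open import Data.Product.Function.NonDependent.Propositional using (_×-↔_)
open import Data.Sum using (_⊎_; inj₁; inj₂)
open import Data.Empty using (⊥; ⊥-elim)
open import Function using (_∘_; flip)
open import Function.Bundles using (_⇔_; mk⇔; _↔_; mk↔ₛ′; Inverse; Injection; Equivalence)
open import Function.Definitions using (Injective)
open import Function.Properties.Inverse using (↔-refl; ↔-sym; ↔-trans; ↔⇒↣)
open import Relation.Nullary using (¬_; Dec; yes; no; contradiction)
open import Relation.Binary using (IsEquivalence)
open import Relation.Binary.PropositionalEquality using (_≡_; _≢_; refl; sym; trans; cong; cong₂; subst)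

record Enumeration {n : ℕ} (P : Fin n → Set) (c : ℕ) : Set where
  field
    el           : Fin c → Fin n
    el-injective : Injective _≡_ _≡_ el
    el-sound     : ∀ t → P (el t)
    el-complete  : ∀ {x} → P x → ∃[ t ] el t ≡ x

module _ {n c : ℕ} {P : Fin (suc n) → Set} (E : Enumeration (P ∘ suc) c) where
  open Enumeration E

  skip-zero : ¬ P zero → Enumeration P c
  skip-zero ¬P0 = record
    { el = suc ∘ el ; el-injective = el-injective ∘ suc-injective ; el-sound = el-sound ; el-complete = complete }
    where
    complete : ∀ {x} → P x → ∃[ t ] suc (el t) ≡ x
    complete {zero}  P0 = contradiction P0 ¬P0
    complete {suc x} Px = let t , eq = el-complete Px in t , cong suc eq

  keep-zero : P zero → Enumeration P (suc c)
  keep-zero P0 = record { el = el′ ; el-injective = injective ; el-sound = sound ; el-complete = complete }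
    where
    el′ : Fin (suc c) → Fin (suc n)
    el′ zero    = zero
    el′ (suc t) = suc (el t)
    injective : Injective _≡_ _≡_ el′
    injective {zero}  {zero}  _  = refl
    injective {suc s} {suc t} eq = cong suc (el-injective (suc-injective eq))
    sound : ∀ t → P (el′ t)
    sound zero    = P0
    sound (suc t) = el-sound t
    complete : ∀ {x} → P x → ∃[ t ] el′ t ≡ x
    complete {zero}  _  = zero , refl
    complete {suc x} Px = let t , eq = el-complete Px in suc t , cong suc eq

enumerate : ∀ {n} (b : Fin n → Bool) {P : Fin n → Set} → (∀ x → b x ≡ true ⇔ P x) →
            Enumeration P (countFin n b)
enumerate {zero} b spec = record
  { el = λ () ; el-injective = λ { {()} } ; el-sound = λ () ; el-complete = λ { {()} } }
enumerate {suc n} b spec with b zero | spec zero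
... | true  | b₀ = keep-zero (enumerate (b ∘ suc) (spec ∘ suc)) (Equivalence.to b₀ refl)
... | false | b₀ = skip-zero (enumerate (b ∘ suc) (spec ∘ suc)) (false≢true ∘ Equivalence.from b₀)
  where
  false≢true : false ≢ true
  false≢true ()

⌊⌋≡true⇔ : ∀ {P : Set} (p? : Dec P) → ⌊ p? ⌋ ≡ true ⇔ P
⌊⌋≡true⇔ (yes p) = mk⇔ (λ _ → p) (λ _ → refl)
⌊⌋≡true⇔ (no ¬p) = mk⇔ (λ ()) (λ p → contradiction p ¬p)

⌊⌋∧⌊⌋≡true⇔ : ∀ {P Q : Set} (p? : Dec P) (q? : Dec Q) → (⌊ p? ⌋ ∧ ⌊ q? ⌋) ≡ true ⇔ (P × Q)
⌊⌋∧⌊⌋≡true⇔ (yes p) (yes q) = mk⇔ (λ _ → p , q) (λ _ → refl)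
⌊⌋∧⌊⌋≡true⇔ (yes _) (no ¬q) = mk⇔ (λ ()) (λ (_ , q) → contradiction q ¬q)
⌊⌋∧⌊⌋≡true⇔ (no ¬p) _       = mk⇔ (λ ()) (λ (p , _) → contradiction p ¬p)

Enumeration-witness : ∀ {n c} {P : Fin n → Set} → Enumeration P c → c ≢ 0 → ∃ P
Enumeration-witness {c = zero}  _ c≢0 = contradiction refl c≢0
Enumeration-witness {c = suc _} E _   = Enumeration.el E zero , Enumeration.el-sound E zero

Enumeration-empty : ∀ {n} {P : Fin n → Set} → Enumeration P 0 → ∀ {x} → ¬ P x
Enumeration-empty E Px with Enumeration.el-complete E Px
... | () , _

Fin-injective⇒surjective : ∀ {n} {φ : Fin n → Fin n} → Injective _≡_ _≡_ φ → ∀ y → ∃[ x ] φ x ≡ y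
Fin-injective⇒surjective {suc n} {φ} φ-injective y with any? (λ x → φ x ≟ y)
... | yes hit  = hit
... | no  miss = contradiction (injective⇒≤ ψ-injective) 1+n≰n
  where
  avoids : ∀ x → y ≢ φ x
  avoids x eq = miss (x , sym eq)
  ψ : Fin (suc n) → Fin n
  ψ x = punchOut (avoids x)
  ψ-injective : Injective _≡_ _≡_ ψ
  ψ-injective eq = φ-injective (punchOut-injective (avoids _) (avoids _) eq)

Fin-↔⇒≡ : ∀ {m n} → Fin m ↔ Fin n → m ≡ n
Fin-↔⇒≡ φ =
  cantor-schröder-bernstein (Injection.injective (↔⇒↣ φ)) (Injection.injective (↔⇒↣ (↔-sym φ)))

∷↔× : ∀ {A : Set} {n} → Vec A (suc n) ↔ (A × Vec A n)
∷↔× = mk↔ₛ′ (λ { (x ∷ xs) → x , xs }) (uncurry _∷_) (λ _ → refl) (λ { (x ∷ xs) → refl })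

Vec↔Fin^ : ∀ {e} d → Vec (Fin e) d ↔ Fin (e ^ d)
Vec↔Fin^ zero    = mk↔ₛ′ (λ _ → zero) (λ _ → []) (λ { zero → refl }) (λ { [] → refl })
Vec↔Fin^ (suc d) = ↔-trans ∷↔× (↔-trans (↔-refl ×-↔ Vec↔Fin^ d) (↔-sym *↔×))

Path-preserves : ∀ {n} {E : Fin n → Fin n → Set} (P : Fin n → Set) →
                 (∀ {x y} → E x y → P x → P y) → ∀ {x y} → Path E x y → P x → P y
Path-preserves P closed here          Px = Px
Path-preserves P closed (step xy yz) Px = Path-preserves P closed yz (closed xy Px)

∃≢ : ∀ {e} → 1 < e → (a : Fin e) → ∃[ b ] b ≢ a
∃≢ (s≤s (s≤s z≤n)) a = punchIn a zero , punchInᵢ≢i a zero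

lookup-extensionality : ∀ {A : Set} {n} {u v : Vec A n} → (∀ k → lookup u k ≡ lookup v k) → u ≡ v
lookup-extensionality {u = u} {v = v} eq =
  trans (sym (tabulate∘lookup u)) (trans (tabulate-cong eq) (tabulate∘lookup v))

module _ {d e : ℕ} where
  private
    variable
      k k′ : Fin d
      u u′ v w x : Vec (Fin e) d

  record SameLine (k : Fin d) (u v : Vec (Fin e) d) : Set where
    constructor sameLine
    field agree : ∀ {k′} → k′ ≢ k → lookup u k′ ≡ lookup v k′
  open SameLine

  SameLine-refl : SameLine k u u
  SameLine-refl = sameLine λ _ → refl

  SameLine-sym : SameLine k u v → SameLine k v u
  SameLine-sym uv = sameLine λ ne → sym (agree uv ne)

  SameLine-trans : SameLine k u v → SameLine k v w → SameLine k u w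
  SameLine-trans uv vw = sameLine λ ne → trans (agree uv ne) (agree vw ne)

  SameLine-≡ : SameLine k u v → lookup u k ≡ lookup v k → u ≡ v
  SameLine-≡ {k = k} {u = u} {v = v} uv eqₖ = lookup-extensionality agreeAt
    where
    agreeAt : ∀ k′ → lookup u k′ ≡ lookup v k′
    agreeAt k′ with k′ ≟ k
    ... | yes refl = eqₖ
    ... | no k′≢k  = agree uv k′≢k

  SameLine-[]≔ : (a : Fin e) → SameLine k u (u [ k ]≔ a)
  SameLine-[]≔ {u = u} a = sameLine λ ne → sym (lookup∘update′ ne u a)

  SameLine⇒≡[]≔ : SameLine k u v → v ≡ u [ k ]≔ lookup v k
  SameLine⇒≡[]≔ {k = k} {u = u} {v = v} uv =
    SameLine-≡ (SameLine-trans (SameLine-sym uv) (SameLine-[]≔ _)) (sym (lookup∘update k u (lookup v k)))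

  SameLine-differ : ∀ {c} → SameLine k u v → lookup u c ≢ lookup v c → c ≡ k
  SameLine-differ {k = k} {c = c} uv ne with c ≟ k
  ... | yes c≡k = c≡k
  ... | no  c≢k = contradiction (agree uv c≢k) ne

  HammingAdj⇒SameLine : (uv : HammingAdj d e u v) → SameLine (proj₁ uv) u v
  HammingAdj⇒SameLine (_ , _ , agreeElsewhere) = sameLine (agreeElsewhere _)

  SameLine⇒HammingAdj : SameLine k u v → u ≢ v → HammingAdj d e u v
  SameLine⇒HammingAdj {k = k} uv u≢v = k , u≢v ∘ SameLine-≡ uv , λ _ → agree uv

  HammingAdj-sym : HammingAdj d e u v → HammingAdj d e v u
  HammingAdj-sym (k , neₖ , agreeElsewhere) = k , neₖ ∘ sym , λ k′ ne → sym (agreeElsewhere k′ ne)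

  triangle-direction : (uv : HammingAdj d e u v) (uw : HammingAdj d e u w) →
                       HammingAdj d e v w → proj₁ uv ≡ proj₁ uw
  triangle-direction {u = u} {v = v} {w = w} (k , neₖ , agreeₖ) (k′ , neₖ′ , agreeₖ′) vw with k ≟ k′
  ... | yes k≡k′ = k≡k′
  ... | no  k≢k′ =
    contradiction (trans (SameLine-differ vw′ differₖ) (sym (SameLine-differ vw′ differₖ′))) k≢k′
    where
    vw′ : SameLine (proj₁ vw) v w
    vw′ = HammingAdj⇒SameLine {u = v} {v = w} vw
    differₖ : lookup v k ≢ lookup w k
    differₖ eq = neₖ (trans (agreeₖ′ k k≢k′) (sym eq))
    differₖ′ : lookup v k′ ≢ lookup w k′
    differₖ′ eq = neₖ′ (trans (agreeₖ k′ (k≢k′ ∘ sym)) eq)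

  line-has-second-point : 1 < e → (k : Fin d) (u : Vec (Fin e) d) →
                          ∃[ u′ ] (SameLine k u u′ × lookup u k ≢ lookup u′ k)
  line-has-second-point 1<e k u =
    u [ k ]≔ a , SameLine-[]≔ a , λ eq → a≢uₖ (trans (sym (lookup∘update k u a)) (sym eq))
    where
    a : Fin e
    a = proj₁ (∃≢ 1<e (lookup u k))
    a≢uₖ : a ≢ lookup u k
    a≢uₖ = proj₂ (∃≢ 1<e (lookup u k))

  line-direction-unique : 1 < e → (∀ {w} → SameLine k u w → SameLine k′ u w) → k ≡ k′
  line-direction-unique {k = k} {u = u} 1<e k⊆k′ =
    let y , uy , differₖ = line-has-second-point 1<e k u in SameLine-differ (k⊆k′ uy) differₖ

  adjacent-to-line⇒onLine : 1 < e → (∀ {w} → SameLine k u w → HammingAdj d e x w) → SameLine k u x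
  adjacent-to-line⇒onLine {k = k} {u = u} {x = x} 1<e adjacent with line-has-second-point 1<e k u
  ... | y , uy , differₖ =
    subst (λ c → SameLine c u x) (sym (triangle-direction {u = u} {v = y} {w = x} uy′ ux yx))
          (HammingAdj⇒SameLine {u = u} {v = x} ux)
    where
    uy′ : HammingAdj d e u y
    uy′ = SameLine⇒HammingAdj uy (differₖ ∘ cong (λ z → lookup z k))
    ux : HammingAdj d e u x
    ux = HammingAdj-sym {u = x} {v = u} (adjacent SameLine-refl)
    yx : HammingAdj d e y x
    yx = HammingAdj-sym {u = x} {v = y} (adjacent uy)

  clique⇒line : {C : Vec (Fin e) d → Set} →
                (∀ {v w} → C v → C w → v ≢ w → HammingAdj d e v w) →
                (ws : Fin e → Vec (Fin e) d) → Injective _≡_ _≡_ ws → (∀ t → C (ws t)) →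
                C u → C v → u ≢ v → ∃[ k ] ∀ x → C x ⇔ SameLine k u x
  clique⇒line {u = u} {v = v} {C = C} clique ws ws-injective ws∈C u∈C v∈C u≢v =
    direction , λ x → mk⇔ (onLine x) (inC x)
    where
    uv : HammingAdj d e u v
    uv = clique u∈C v∈C u≢v
    direction : Fin d
    direction = proj₁ uv
    onLine : ∀ x → C x → SameLine direction u x
    onLine x x∈C with ≡-dec _≟_ u x | ≡-dec _≟_ v x
    ... | yes refl | _        = SameLine-refl
    ... | no _     | yes refl = HammingAdj⇒SameLine {u = u} {v = v} uv
    ... | no u≢x   | no v≢x   =
      subst (λ c → SameLine c u x)
            (sym (triangle-direction {u = u} {v = v} {w = x} uv ux (clique v∈C x∈C v≢x)))
            (HammingAdj⇒SameLine {u = u} {v = x} ux)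
      where
      ux : HammingAdj d e u x
      ux = clique u∈C x∈C u≢x
    ws-onLine : ∀ s t → SameLine direction (ws s) (ws t)
    ws-onLine s t = SameLine-trans (SameLine-sym (onLine (ws s) (ws∈C s))) (onLine (ws t) (ws∈C t))
    coordinate-injective : Injective _≡_ _≡_ (λ t → lookup (ws t) direction)
    coordinate-injective {s} {t} eq = ws-injective (SameLine-≡ (ws-onLine s t) eq)
    inC : ∀ x → SameLine direction u x → C x
    inC x ux with Fin-injective⇒surjective coordinate-injective (lookup x direction)
    ... | t , eq = subst C (SameLine-≡ (SameLine-trans (SameLine-sym (onLine (ws t) (ws∈C t))) ux) eq) (ws∈C t)

  NeighbourhoodsAreLines : (Vec (Fin e) d → Vec (Fin e) d → Set) → Set
  NeighbourhoodsAreLines B = ∀ {u v} → B u v → ∃[ k ] ∀ u′ → B u′ v ⇔ SameLine k u u′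

  module LineNeighbourhoods
    (1<e : 1 < e) (d<e : d < e) (B : Vec (Fin e) d → Vec (Fin e) d → Set)
    (linesˡ : NeighbourhoodsAreLines B) (linesʳ : NeighbourhoodsAreLines (flip B))
    (total : ∀ u → ∃ (B u))
    where

    module At (u : Vec (Fin e) d) where
      -- opaque: these are large proof terms which the unifier must never unfold
      opaque
        v₀ : Vec (Fin e) d
        v₀ = proj₁ (total u)

        uv₀ : B u v₀
        uv₀ = proj₂ (total u)

        k₀ : Fin d
        k₀ = proj₁ (linesʳ uv₀)

        neighbours : ∀ v → B u v ⇔ SameLine k₀ v₀ v
        neighbours = proj₂ (linesʳ uv₀)

        vₐ : Fin e → Vec (Fin e) d
        vₐ a = v₀ [ k₀ ]≔ a

        uvₐ : ∀ a → B u (vₐ a)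
        uvₐ a = Equivalence.from (neighbours (vₐ a)) (SameLine-[]≔ a)

        direction : Fin e → Fin d
        direction a = proj₁ (linesˡ (uvₐ a))

        -- pigeonhole: the e lines N⁻(vₐ) through u have only d < e possible directions
        collision : ∃[ a₁ ] ∃[ a₂ ] (a₁ <ᶠ a₂ × direction a₁ ≡ direction a₂)
        collision = pigeonhole d<e direction

        a₁ a₂ : Fin e
        a₁ = proj₁ collision
        a₂ = proj₁ (proj₂ collision)

        a₁<a₂ : a₁ <ᶠ a₂
        a₁<a₂ = proj₁ (proj₂ (proj₂ collision))

        same-direction : direction a₁ ≡ direction a₂
        same-direction = proj₂ (proj₂ (proj₂ collision))

        κ : Fin d
        κ = direction a₁

        -- u′ is adjacent to vₐ a₁ and vₐ a₂, which differ in coordinate k₀,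
        -- so N⁺(u′) is the k₀-line through them, which is N⁺(u).
        shares : ∀ {u′ v} → SameLine κ u u′ → B u v → B u′ v
        shares {u′} {v} uu′ uv =
          Equivalence.from (N⁺ v) (subst (λ c → SameLine c (vₐ a₁) v) k₀≡k′ vₐ₁v)
          where
          u′vₐ₁ : B u′ (vₐ a₁)
          u′vₐ₁ = Equivalence.from (proj₂ (linesˡ (uvₐ a₁)) u′) uu′
          u′vₐ₂ : B u′ (vₐ a₂)
          u′vₐ₂ = Equivalence.from (proj₂ (linesˡ (uvₐ a₂)) u′)
                    (subst (λ c → SameLine c u u′) same-direction uu′)
          N⁺ : ∀ v → B u′ v ⇔ SameLine (proj₁ (linesʳ u′vₐ₁)) (vₐ a₁) v
          N⁺ = proj₂ (linesʳ u′vₐ₁)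
          k₀≡k′ : k₀ ≡ proj₁ (linesʳ u′vₐ₁)
          k₀≡k′ = SameLine-differ (Equivalence.to (N⁺ (vₐ a₂)) u′vₐ₂) λ eq →
            <-irrefl (trans (sym (lookup∘update k₀ v₀ a₁)) (trans eq (lookup∘update k₀ v₀ a₂)))
                     a₁<a₂
          vₐ₁v : SameLine k₀ (vₐ a₁) v
          vₐ₁v = SameLine-trans (SameLine-sym (SameLine-[]≔ a₁)) (Equivalence.to (neighbours v) uv)

        κ-neighbourhood : ∀ {v} → B u v → ∀ u′ → B u′ v ⇔ SameLine κ u u′
        κ-neighbourhood {v} uv u′ =
          mk⇔ (subst (λ c → SameLine c u u′) (sym κ≡k) ∘ Equivalence.to (N⁻ u′)) (λ uu′ → shares uu′ uv)
          where
          N⁻ : ∀ u′ → B u′ v ⇔ SameLine (proj₁ (linesˡ uv)) u u′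
          N⁻ = proj₂ (linesˡ uv)
          κ≡k : κ ≡ proj₁ (linesˡ uv)
          κ≡k = line-direction-unique 1<e λ {w} uw → Equivalence.to (N⁻ w) (shares uw uv)

    opaque
      κ : Vec (Fin e) d → Fin d
      κ = At.κ

      κ-neighbourhood : B u v → ∀ u′ → B u′ v ⇔ SameLine (κ u) u u′
      κ-neighbourhood {u} = At.κ-neighbourhood u

      κ-constant : SameLine (κ u) u u′ → κ u′ ≡ κ u
      κ-constant {u} {u′} uu′ = line-direction-unique 1<e λ {w} u′w →
        SameLine-trans (SameLine-sym uu′)
          (Equivalence.to (κ-neighbourhood (At.uv₀ u) w) (Equivalence.from (κ-neighbourhood u′v₀ w) u′w))
        where
        u′v₀ : B u′ (At.v₀ u)
        u′v₀ = At.shares u uu′ (At.uv₀ u)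

      κ-shares : SameLine (κ u) u u′ → B u v ⇔ B u′ v
      κ-shares {u} {u′} uu′ = mk⇔ (At.shares u uu′) λ u′v →
        Equivalence.from (κ-neighbourhood u′v u)
          (subst (λ c → SameLine c u′ u) (sym (κ-constant uu′)) (SameLine-sym uu′))

  module LinePartition (o : Fin e) (κ : Vec (Fin e) d → Fin d)
    (κ-constant : ∀ {u u′} → SameLine (κ u) u u′ → κ u′ ≡ κ u)
    where

    base : Vec (Fin e) d → Vec (Fin e) d
    base u = u [ κ u ]≔ o

    IsBase : Vec (Fin e) d → Set
    IsBase r = base r ≡ r

    u-base : SameLine (κ u) u (base u)
    u-base = SameLine-[]≔ o

    κ-base : κ (base u) ≡ κ u
    κ-base = κ-constant u-base

    base-constant : SameLine (κ u) u u′ → base u′ ≡ base u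
    base-constant {u} {u′} uu′ =
      SameLine-≡ (SameLine-trans (SameLine-sym u′-base′) (SameLine-trans (SameLine-sym uu′) u-base))
                 (trans base′-at-κ (sym (lookup∘update (κ u) u o)))
      where
      u′-base′ : SameLine (κ u) u′ (base u′)
      u′-base′ = subst (λ c → SameLine c u′ (base u′)) (κ-constant uu′) u-base
      base′-at-κ : lookup (base u′) (κ u) ≡ o
      base′-at-κ = subst (λ c → lookup (base u′) c ≡ o) (κ-constant uu′) (lookup∘update (κ u′) u′ o)

    encoding : Vec (Fin e) d ↔ Fin (e ^ d)
    encoding = Vec↔Fin^ d

    open Inverse encoding using () renaming (to to encode; from to decode)

    lineCount : ℕ
    lineCount = countFin (e ^ d) (λ x → ⌊ ≡-dec _≟_ (base (decode x)) (decode x) ⌋)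

    opaque
      bases : Enumeration (IsBase ∘ decode) lineCount
      bases = enumerate _ (λ x → ⌊⌋≡true⇔ (≡-dec _≟_ (base (decode x)) (decode x)))

    lineBase : Fin lineCount → Vec (Fin e) d
    lineBase t = decode (Enumeration.el bases t)

    lineBase-injective : Injective _≡_ _≡_ lineBase
    lineBase-injective eq = Enumeration.el-injective bases
      (trans (sym (Inverse.strictlyInverseˡ encoding _))
             (trans (cong encode eq) (Inverse.strictlyInverseˡ encoding _)))

    lineIndex : Vec (Fin e) d → Fin lineCount
    lineIndex u = proj₁ (Enumeration.el-complete bases base-isBase)
      where
      base-isBase : IsBase (decode (encode (base u)))
      base-isBase = subst IsBase (sym (Inverse.strictlyInverseʳ encoding (base u))) (base-constant u-base)

    lineBase-lineIndex : ∀ u → lineBase (lineIndex u) ≡ base u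
    lineBase-lineIndex u =
      trans (cong decode (proj₂ (Enumeration.el-complete bases _))) (Inverse.strictlyInverseʳ encoding (base u))

    lineIndex-constant : SameLine (κ u) u u′ → lineIndex u′ ≡ lineIndex u
    lineIndex-constant {u} {u′} uu′ =
      lineBase-injective (trans (lineBase-lineIndex u′) (trans (base-constant uu′) (sym (lineBase-lineIndex u))))

    lineIndex-lineBase : ∀ t → lineIndex (lineBase t) ≡ t
    lineIndex-lineBase t = lineBase-injective (trans (lineBase-lineIndex (lineBase t)) (Enumeration.el-sound bases t))

    onLineOf-lineIndex : ∀ u → SameLine (κ (lineBase (lineIndex u))) (lineBase (lineIndex u)) u
    onLineOf-lineIndex u = subst (λ r → SameLine (κ r) r u) (sym (lineBase-lineIndex u))
                               (subst (λ c → SameLine c (base u) u) (sym κ-base) (SameLine-sym u-base))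

    point : Fin lineCount × Fin e → Vec (Fin e) d
    point (t , a) = lineBase t [ κ (lineBase t) ]≔ a

    point-onLine : ∀ t a → SameLine (κ (lineBase t)) (lineBase t) (point (t , a))
    point-onLine t a = SameLine-[]≔ a

    lineIndex-point : ∀ t a → lineIndex (point (t , a)) ≡ t
    lineIndex-point t a = trans (lineIndex-constant (point-onLine t a)) (lineIndex-lineBase t)

    point-coordinates : ∀ t → SameLine (κ (lineBase t)) (lineBase t) u → point (t , lookup u (κ u)) ≡ u
    point-coordinates {u} t onLine =
      trans (cong (λ c → lineBase t [ κ (lineBase t) ]≔ lookup u c) (κ-constant onLine))
            (sym (SameLine⇒≡[]≔ onLine))

    point↔ : (Fin lineCount × Fin e) ↔ Vec (Fin e) d
    point↔ = mk↔ₛ′ point (λ u → lineIndex u , lookup u (κ u))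
                   (λ u → point-coordinates (lineIndex u) (onLineOf-lineIndex u)) coordinates-point
      where
      coordinates-point : ∀ ta → (lineIndex (point ta) , lookup (point ta) (κ (point ta))) ≡ ta
      coordinates-point (t , a) = cong₂ _,_ (lineIndex-point t a)
        (trans (cong (lookup (point (t , a))) (κ-constant (point-onLine t a)))
               (lookup∘update (κ (lineBase t)) (lineBase t) a))

    lineCount*e≡e^d : lineCount * e ≡ e ^ d
    lineCount*e≡e^d = Fin-↔⇒≡ (↔-trans *↔× (↔-trans point↔ encoding))

    lineCount≡e^[d∸1] : 1 ≤ d → lineCount ≡ e ^ (d ∸ 1)
    lineCount≡e^[d∸1] (s≤s z≤n) =
      *-cancelʳ-≡ lineCount _ e {{nonZeroIndex o}} (trans lineCount*e≡e^d (*-comm e _))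

module _ {n m : ℕ} (A : AssocScheme n m) where
  private
    variable
      x y z : Fin n
      h i j : Fin (suc m)

  R-refl : R A x x ≡ zero
  R-refl {x} = Equivalence.from (R-id A x x) refl

  R-flip : R A x y ≡ h → R A y x ≡ h
  R-flip {x} {y} = trans (R-sym A y x)

  Between : Fin n → Fin n → Fin (suc m) → Fin (suc m) → Fin n → Set
  Between x y i j z = R A x z ≡ i × R A z y ≡ j

  between-enumeration : ∀ x y i j → Enumeration (Between x y i j) (p A (R A x y) i j)
  between-enumeration x y i j = subst (Enumeration (Between x y i j)) (p-law A x y i j)
    (enumerate _ (λ z → ⌊⌋∧⌊⌋≡true⇔ (R A x z ≟ i) (R A z y ≟ j)))

  line-image-isMaxClique : ∀ {d e} {Y : Fin n → Set} → 1 < e → (F : GraphIso (HammingAdj d e) Y (Γ A i)) →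
                           ∀ {k u} {C : Fin n → Set} →
                           (∀ y → C y ⇔ (∃[ w ] (GraphIso.f F w ≡ y × SameLine k u w))) →
                           IsMaxCliqueOfSize A i Y e C
  line-image-isMaxClique {i} {e = e} {Y = Y} 1<e F {k} {u} {C} C⇔ = C⊆Y , clique , maximal , size
    where
    open GraphIso F
    C⊆Y : ∀ y → C y → Y y
    C⊆Y y Cy = let w , fw≡y , _ = Equivalence.to (C⇔ y) Cy in subst Y fw≡y (f-in w)
    clique : ∀ y z → C y → C z → y ≢ z → R A y z ≡ i
    clique y z Cy Cz y≢z with Equivalence.to (C⇔ y) Cy | Equivalence.to (C⇔ z) Cz
    ... | w , refl , uw | w′ , refl , uw′ =
      Equivalence.from (f-adj w w′) (SameLine⇒HammingAdj (SameLine-trans (SameLine-sym uw) uw′) (y≢z ∘ cong f))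
    maximal : ∀ z → Y z → ¬ C z → ¬ (∀ y → C y → R A z y ≡ i)
    maximal z Yz ¬Cz adjacent with f-onto z Yz
    ... | x , refl = ¬Cz (Equivalence.from (C⇔ (f x)) (x , refl , adjacent-to-line⇒onLine 1<e λ {w} uw →
      Equivalence.to (f-adj x w) (adjacent (f w) (Equivalence.from (C⇔ (f w)) (w , refl , uw)))))
    line : Fin e → Fin n
    line a = f (u [ k ]≔ a)
    size : HasSize C e
    size = tabulate line , injective , λ y → mk⇔ (listed y) (enumerated y)
      where
      injective : ∀ a b → lookup (tabulate line) a ≡ lookup (tabulate line) b → a ≡ b
      injective a b eq = trans (sym (lookup∘update k u a))
        (trans (cong (λ w → lookup w k)
                     (f-inj _ _ (trans (sym (lookup∘tabulate line a)) (trans eq (lookup∘tabulate line b)))))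
               (lookup∘update k u b))
      listed : ∀ y → C y → ∃[ a ] lookup (tabulate line) a ≡ y
      listed y Cy with Equivalence.to (C⇔ y) Cy
      ... | w , refl , uw = lookup w k , trans (lookup∘tabulate line _) (cong f (sym (SameLine⇒≡[]≔ uw)))
      enumerated : ∀ y → ∃[ a ] lookup (tabulate line) a ≡ y → C y
      enumerated y (a , refl) =
        Equivalence.from (C⇔ _) (u [ k ]≔ a , sym (lookup∘tabulate line a) , SameLine-[]≔ a)

  module Imprimitive {T : Fin (suc m) → Set} (imprimitive : IsImprimitivitySet A T) where
    private
      module ∼ = IsEquivalence imprimitive
      variable
        Y : Fin n → Set

    class-related : IsClass A T Y → Y x → Y z → T (R A x z)
    class-related (_ , Y⇔) Yx Yz = ∼.trans (∼.sym (Equivalence.to (Y⇔ _) Yx)) (Equivalence.to (Y⇔ _) Yz)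

    class-closed : IsClass A T Y → Y x → T (R A x z) → Y z
    class-closed (_ , Y⇔) Yx xz = Equivalence.from (Y⇔ _) (∼.trans (Equivalence.to (Y⇔ _) Yx) xz)

    module _ {i j : Fin (suc m)} (Ti : T i) (i≢0 : i ≢ zero) (¬Tj : ¬ T j) {d e₂ : ℕ}
      (p-jij : p A j i j ≡ suc e₂) (p-ji′j : ∀ i′ → T i′ → i′ ≢ zero → i′ ≢ i → p A j i′ j ≡ 0)
      (1≤d : 1 ≤ d) (d<e : d < suc (suc e₂))
      where

      e : ℕ
      e = suc (suc e₂)

      1<e : 1 < e
      1<e = s≤s (s≤s z≤n)

      j-free : IsClass A T Y → Y x → Y z → R A x z ≢ j
      j-free CY Yx Yz xz = ¬Tj (subst T xz (class-related CY Yx Yz))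

      module HammingClass (CY : IsClass A T Y) (F : GraphIso (HammingAdj d e) Y (Γ A i)) where
        open GraphIso F

        jNeighbours-adjacent : ∀ {u u′} → R A (f u) y ≡ j → R A (f u′) y ≡ j → u ≢ u′ →
                               HammingAdj d e u u′
        jNeighbours-adjacent {y} {u} {u′} uy u′y u≢u′ with R A (f u) (f u′) ≟ i
        ... | yes uu′ = Equivalence.to (f-adj u u′) uu′
        ... | no  ¬uu′ =
          ⊥-elim (Enumeration-empty (subst (Enumeration _) p≡0 (between-enumeration (f u) y _ j)) (refl , u′y))
          where
          p≡0 : p A (R A (f u) y) (R A (f u) (f u′)) j ≡ 0
          p≡0 = trans (cong (λ h → p A h _ j) uy)
                  (p-ji′j _ (class-related CY (f-in u) (f-in u′))
                            (u≢u′ ∘ f-inj u u′ ∘ Equivalence.to (R-id A _ _)) ¬uu′)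

        jNeighbourhood-isLine : ∀ {u} → R A (f u) y ≡ j → ∃[ k ] ∀ u′ → R A (f u′) y ≡ j ⇔ SameLine k u u′
        jNeighbourhood-isLine {y} {u} uy =
          clique⇒line jNeighbours-adjacent ws ws-injective ws-jNeighbour
                      uy (ws-jNeighbour (suc zero)) (other≢u ∘ sym)
          where
          E : Enumeration (Between (f u) y i j) (suc e₂)
          E = subst (Enumeration _) (trans (cong (λ h → p A h i j) uy) p-jij) (between-enumeration (f u) y i j)
          open Enumeration E
          inY : ∀ t → Y (el t)
          inY t = class-closed CY (f-in u) (subst T (sym (proj₁ (el-sound t))) Ti)
          other : Fin (suc e₂) → Vec (Fin e) d
          other t = proj₁ (f-onto (el t) (inY t))
          f-other : ∀ {t} → f (other t) ≡ el t
          f-other {t} = proj₂ (f-onto (el t) (inY t))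
          other≢u : ∀ {t} → other t ≢ u
          other≢u eq = i≢0 (trans (sym (proj₁ (el-sound _)))
                                  (trans (cong (R A (f u)) (trans (sym f-other) (cong f eq))) R-refl))
          ws : Fin e → Vec (Fin e) d
          ws zero    = u
          ws (suc t) = other t
          ws-jNeighbour : ∀ t → R A (f (ws t)) y ≡ j
          ws-jNeighbour zero    = uy
          ws-jNeighbour (suc t) = subst (λ z → R A z y ≡ j) (sym f-other) (proj₂ (el-sound t))
          ws-injective : Injective _≡_ _≡_ ws
          ws-injective {zero}  {zero}  _  = refl
          ws-injective {zero}  {suc _} eq = contradiction (sym eq) other≢u
          ws-injective {suc _} {zero}  eq = contradiction eq other≢u
          ws-injective {suc _} {suc _} eq = cong suc (el-injective (trans (sym f-other) (trans (cong f eq) f-other)))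

        jNeighbour-from-tilde : ∀ {u} → Tilde A T (R A (f u) y) j → ∃[ u′ ] R A (f u′) y ≡ j
        jNeighbour-from-tilde {y} {u} (i′ , Ti′ , p≢0) with Enumeration-witness (between-enumeration _ _ _ _) p≢0
        ... | z , uz , zy = proj₁ (f-onto z Yz) , subst (λ w → R A w y ≡ j) (sym (proj₂ (f-onto z Yz))) zy
          where
          Yz : Y z
          Yz = class-closed CY (f-in u) (subst T (sym uz) Ti′)

      module JoinedClasses {Y Y′ : Fin n → Set} (CY : IsClass A T Y) (CY′ : IsClass A T Y′)
        (F : GraphIso (HammingAdj d e) Y (Γ A i)) (G : GraphIso (HammingAdj d e) Y′ (Γ A i))
        (tilde : ∀ x y → Y x → Y′ y → Tilde A T (R A x y) j)
        where

        open GraphIso F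
        open GraphIso G using () renaming (f to g; f-inj to g-inj; f-in to g-in; f-onto to g-onto)

        B : Vec (Fin e) d → Vec (Fin e) d → Set
        B u v = R A (f u) (g v) ≡ j

        opaque
          linesˡ : NeighbourhoodsAreLines B
          linesˡ = HammingClass.jNeighbourhood-isLine CY F

          linesʳ : NeighbourhoodsAreLines (flip B)
          linesʳ {v} {u} uv =
            proj₁ L , λ v′ → mk⇔ (Equivalence.to (proj₂ L v′) ∘ R-flip) (R-flip ∘ Equivalence.from (proj₂ L v′))
            where
            L : ∃[ k ] ∀ v′ → R A (g v′) (f u) ≡ j ⇔ SameLine k v v′
            L = HammingClass.jNeighbourhood-isLine CY′ G (R-flip uv)

          total : ∀ u → ∃ (B u)
          total u with HammingClass.jNeighbour-from-tilde CY′ G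
                         (subst (λ h → Tilde A T h j) (R-sym A (f u) (g u)) (tilde (f u) (g u) (f-in u) (g-in u)))
          ... | v , vu = v , R-flip vu

          totalʳ : ∀ v → ∃[ u ] B u v
          totalʳ v = HammingClass.jNeighbour-from-tilde CY F (tilde (f v) (g v) (f-in v) (g-in v))

        disjoint : Y x → Y′ x → ⊥
        disjoint Yx Y′x with f-onto _ Yx
        ... | u , refl = j-free CY′ Y′x (g-in (proj₁ (total u))) (proj₂ (total u))

        open LineNeighbourhoods 1<e d<e B linesˡ linesʳ total
        open LinePartition zero κ κ-constant

        partner : Fin lineCount × Fin e → Vec (Fin e) d
        partner (t , a) = At.v₀ (lineBase t) [ At.k₀ (lineBase t) ]≔ a

        lineBase-partner : ∀ t a → B (lineBase t) (partner (t , a))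
        lineBase-partner t a = Equivalence.from (At.neighbours (lineBase t) (partner (t , a))) (SameLine-[]≔ a)

        point-partner : ∀ t a t′ b → B (point (t , a)) (partner (t′ , b)) ⇔ t ≡ t′
        point-partner t a t′ b =
          mk⇔ same-line λ { refl → Equivalence.to (κ-shares (point-onLine t a)) (lineBase-partner t b) }
          where
          same-line : B (point (t , a)) (partner (t′ , b)) → t ≡ t′
          same-line edge = trans (sym (lineIndex-point t a))
            (trans (lineIndex-constant (Equivalence.to (κ-neighbourhood (lineBase-partner t′ b) (point (t , a))) edge))
                   (lineIndex-lineBase t′))

        partner-coordinate : ∀ t a → lookup (partner (t , a)) (At.k₀ (lineBase t)) ≡ a
        partner-coordinate t a = lookup∘update (At.k₀ (lineBase t)) (At.v₀ (lineBase t)) a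

        partner-injective : Injective _≡_ _≡_ partner
        partner-injective {t , a} {t′ , a′} eq = same-coordinate t≡t′ eq
          where
          t≡t′ : t ≡ t′
          t≡t′ = Equivalence.to (point-partner t zero t′ a′)
                   (subst (B (point (t , zero))) eq (Equivalence.from (point-partner t zero t a) refl))
          same-coordinate : t ≡ t′ → partner (t , a) ≡ partner (t′ , a′) → (t , a) ≡ (t′ , a′)
          same-coordinate refl eq′ = cong (t ,_)
            (trans (sym (partner-coordinate t a))
                   (trans (cong (λ v → lookup v (At.k₀ (lineBase t))) eq′) (partner-coordinate t a′)))

        partner-surjective : ∀ v → ∃[ ta ] partner ta ≡ v
        partner-surjective v = (t , lookup v (At.k₀ (lineBase t))) ,
                               sym (SameLine⇒≡[]≔ (Equivalence.to (At.neighbours (lineBase t) v) lineBase-v))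
          where
          u : Vec (Fin e) d
          u = proj₁ (totalʳ v)
          t : Fin lineCount
          t = lineIndex u
          lineBase-v : B (lineBase t) v
          lineBase-v = Equivalence.from (κ-shares (onLineOf-lineIndex u)) (proj₂ (totalʳ v))

        vertex : Fin lineCount × Bool × Fin e → Fin n
        vertex (t , false , a) = f (point (t , a))
        vertex (t , true  , a) = g (partner (t , a))

        vertex-injective : Injective _≡_ _≡_ vertex
        vertex-injective {_ , false , _} {_ , false , _} eq =
          cong (λ (t , a) → t , false , a) (Injection.injective (↔⇒↣ point↔) (f-inj _ _ eq))
        vertex-injective {_ , true  , _} {_ , true  , _} eq =
          cong (λ (t , a) → t , true , a) (partner-injective (g-inj _ _ eq))
        vertex-injective {_ , false , _} {_ , true  , _} eq = ⊥-elim (disjoint (subst Y eq (f-in _)) (g-in _))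
        vertex-injective {_ , true  , _} {_ , false , _} eq = ⊥-elim (disjoint (subst Y (sym eq) (f-in _)) (g-in _))

        vertex-in : ∀ x → Y (vertex x) ⊎ Y′ (vertex x)
        vertex-in (_ , false , _) = inj₁ (f-in _)
        vertex-in (_ , true  , _) = inj₂ (g-in _)

        vertex-onto : ∀ x → Y x ⊎ Y′ x → ∃[ w ] vertex w ≡ x
        vertex-onto x (inj₁ Yx) with f-onto x Yx
        ... | u , refl = (lineIndex u , false , lookup u (κ u)) , cong f (Inverse.strictlyInverseˡ point↔ u)
        vertex-onto x (inj₂ Y′x) with g-onto x Y′x
        ... | v , refl with partner-surjective v
        ... | (t , a) , eq = (t , true , a) , cong g eq

        vertex-adjacent : ∀ x y → Γ A j (vertex x) (vertex y) ⇔ KeeUnionAdj lineCount e x y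
        vertex-adjacent (_ , false , _) (_ , false , _) =
          mk⇔ (⊥-elim ∘ j-free CY (f-in _) (f-in _)) (λ (_ , ne) → ⊥-elim (ne refl))
        vertex-adjacent (_ , true  , _) (_ , true  , _) =
          mk⇔ (⊥-elim ∘ j-free CY′ (g-in _) (g-in _)) (λ (_ , ne) → ⊥-elim (ne refl))
        vertex-adjacent (t , false , a) (t′ , true  , b) =
          mk⇔ (λ edge → Equivalence.to (point-partner t a t′ b) edge , λ ())
              (Equivalence.from (point-partner t a t′ b) ∘ proj₁)
        vertex-adjacent (t , true  , b) (t′ , false , a) =
          mk⇔ (λ edge → sym (Equivalence.to (point-partner t′ a t b) (R-flip edge)) , λ ())
              (R-flip ∘ Equivalence.from (point-partner t′ a t b) ∘ sym ∘ proj₁)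

        kee : GraphIso (KeeUnionAdj (e ^ (d ∸ 1)) e) (λ x → Y x ⊎ Y′ x) (Γ A j)
        kee = subst (λ c → GraphIso (KeeUnionAdj c e) _ _) (lineCount≡e^[d∸1] 1≤d) record
          { f = vertex ; f-inj = λ _ _ → vertex-injective ; f-in = vertex-in
          ; f-onto = vertex-onto ; f-adj = vertex-adjacent }

        Γⱼ[Y∪Y′] : Fin n → Fin n → Set
        Γⱼ[Y∪Y′] = ΓOn A j (λ z → Y z ⊎ Y′ z)

        OnκLineOf : Vec (Fin e) d → Fin n → Set
        OnκLineOf u y = ∃[ w ] (f w ≡ y × SameLine (κ u) u w)

        component : ∀ u y → (Y y × Path Γⱼ[Y∪Y′] (f u) y) ⇔ OnκLineOf u y
        component u y = mk⇔ leave enter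
          where
          Reached : Fin n → Set
          Reached z = OnκLineOf u z ⊎ (∃[ v ] (g v ≡ z × B u v))
          step-closed : ∀ {z z′} → Γⱼ[Y∪Y′] z z′ → Reached z → Reached z′
          step-closed (_ , inj₁ Yz′  , zz′) (inj₁ (w , refl , _))  = ⊥-elim (j-free CY (f-in w) Yz′ zz′)
          step-closed (_ , inj₂ Y′z′ , zz′) (inj₁ (w , refl , uw)) with g-onto _ Y′z′
          ... | v , refl = inj₂ (v , refl , Equivalence.from (κ-shares uw) zz′)
          step-closed (_ , inj₁ Yz′  , zz′) (inj₂ (v , refl , uv)) with f-onto _ Yz′
          ... | w , refl = inj₁ (w , refl , Equivalence.to (κ-neighbourhood uv w) (R-flip zz′))
          step-closed (_ , inj₂ Y′z′ , zz′) (inj₂ (v , refl , _))  = ⊥-elim (j-free CY′ (g-in v) Y′z′ zz′)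
          leave : Y y × Path Γⱼ[Y∪Y′] (f u) y → OnκLineOf u y
          leave (Yy , path) with Path-preserves Reached step-closed path (inj₁ (u , refl , SameLine-refl))
          ... | inj₁ reached          = reached
          ... | inj₂ (v , refl , _) = ⊥-elim (disjoint Yy (g-in v))
          enter : OnκLineOf u y → Y y × Path Γⱼ[Y∪Y′] (f u) y
          enter (w , refl , uw) = f-in w ,
            step (inj₁ (f-in u) , inj₂ (g-in (At.v₀ u)) , At.uv₀ u)
                 (step (inj₂ (g-in (At.v₀ u)) , inj₁ (f-in w) , R-flip (Equivalence.to (κ-shares uw) (At.uv₀ u)))
                       here)

        spread : InducedPartitionIsSpread A i j e Y Y′
        spread x Yx with f-onto x Yx
        ... | u , refl = line-image-isMaxClique 1<e F (component u)

lemma5p1 : ∀ {n m : ℕ} (A : AssocScheme n m) (T : Fin (suc m) → Set)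
    → IsImprimitivitySet A T
    → (i j : Fin (suc m)) → T i → i ≢ zero → ¬ T j
    → (d e : ℕ)
    → p A j i j ≡ e ∸ 1
    → (∀ i' → T i' → i' ≢ zero → i' ≢ i → p A j i' j ≡ 0)
    → (Y Y' : Fin n → Set) → IsClass A T Y → IsClass A T Y'
    → 1 ≤ d → d < e
    → GraphIso (HammingAdj d e) Y (Γ A i)
    → GraphIso (HammingAdj d e) Y' (Γ A i)
    → (∀ x y → Y x → Y' y → Tilde A T (R A x y) j)
    → GraphIso (KeeUnionAdj (e ^ (d ∸ 1)) e) (λ x → Y x ⊎ Y' x) (Γ A j)
    × InducedPartitionIsSpread A i j e Y Y'
    × InducedPartitionIsSpread A i j e Y' Y
lemma5p1 A T _ _ _ _ _ _ _ zero _ _ _ _ _ _ _ () _ _ _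
lemma5p1 A T _ _ _ _ _ _ _ (suc zero) _ _ _ _ _ _ (s≤s z≤n) (s≤s ()) _ _ _
lemma5p1 A T imprimitive i j Ti i≢0 ¬Tj d (suc (suc e₂)) p-jij p-ji′j Y Y′ CY CY′ 1≤d d<e F G tilde =
  Y∪Y′.kee , Y∪Y′.spread , Y′∪Y.spread
  where
  open Imprimitive A {T} imprimitive
  module Y∪Y′ = JoinedClasses Ti i≢0 ¬Tj p-jij p-ji′j 1≤d d<e CY CY′ F G tilde
  module Y′∪Y = JoinedClasses Ti i≢0 ¬Tj p-jij p-ji′j 1≤d d<e CY′ CY G F
                  (λ x y Y′x Yy → subst (λ h → Tilde A T h j) (R-sym A y x) (tilde y x Yy Y′x))
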